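{- Every multi-flock chicken graph (with at least one chicken) contains a 3-Duke.
   Context: A multi-flock chicken graph is a finite orientation of a complete multipartite graph; vertices are called chickens and partite sets are called flocks. "$c$ pecks $d$" means the edge between $c$ and $d$ is oriented from $c$ to $d$ (only chickens in different flocks are joined). A peck chain of length $m$ is a directed path with $m$ edges. A chicken $d$ is an $m$-Duke if every chicken not in the flock of $d$ can be reached from $d$ by a peck chain of length at most $m$. -}

module Defs where

open import Data.Nat using (ℕ; zero; suc; _≤_)
open import Data.Fin using (Fin)
open import Data.Bool using (Bool; true; false; not)
open import Relation.Binary.PropositionalEquality using (_≡_; _≢_)

-- A multi-flock chicken graph with n chickens (labelled by Fin n).
--   * flock c : Fin k is the flock (partite set) of chicken c; the flocks are
--     the nonempty fibres of this map.
--   * pecks c d ≡ true means "c pecks d", i.e. the edge between c and d is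
--     oriented from c to d.
-- It is an orientation of the complete multipartite graph: chickens in the
-- same flock are not joined, and for chickens in different flocks exactly one
-- of the two directions is present.
record ChickenGraph (n : ℕ) : Set where
  field
    k               : ℕ
    flock           : Fin n → Fin k
    pecks           : Fin n → Fin n → Bool
    noPeckSameFlock : ∀ c d → flock c ≡ flock d → pecks c d ≡ false
    orient          : ∀ c d → flock c ≢ flock d → pecks d c ≡ not (pecks c d)

module _ {n : ℕ} (G : ChickenGraph n) where
  open ChickenGraph G

  data PeckChain : ℕ → Fin n → Fin n → Set where
    here : ∀ {c} → PeckChain zero c c
    step : ∀ {m c d e} → pecks c d ≡ true → PeckChain m d e → PeckChain (suc m) c e

  data ReachWithin : ℕ → Fin n → Fin n → Set where
    within : ∀ {m l c d} → l ≤ m → PeckChain l c d → ReachWithin m c d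

  IsDuke : ℕ → Fin n → Set
  IsDuke m d = ∀ c → flock c ≢ flock d → ReachWithin m d c

-- Let v be a chicken whose set of chickens reachable within two pecks is
-- maximal. If some u outside v's flock were not reachable from v within three
-- pecks, then u pecks v, and everything v reaches within two pecks u reaches
-- within two pecks as well (via v, via v's victim w, or, when w is a flockmate
-- of u, directly); since u reaches itself but v does not reach u, the set of u
-- would be strictly larger. Constructively, we climb along such strict
-- inclusions, which cannot go on forever in a finite set.
module Submission where

open import Defs
open import Data.Nat using (ℕ; zero; suc; _≤_; z≤n; s≤s)
open import Data.Nat.Properties using (≤-trans; n≤1+n)
open import Data.Fin using (Fin; zero)
open import Data.Fin.Properties using (any?; _≟_)
open import Data.Fin.Subset using (Subset; _∈_; _⊂_; _⊃_)
open import Data.Fin.Subset.Induction using (⊃-wellFounded; Acc; acc)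
open import Data.Vec using (tabulate)
open import Data.Vec.Properties using (lookup∘tabulate; lookup⇒[]=; []=⇒lookup)
open import Data.Bool using (true; false)
import Data.Bool.Properties as Bool
open import Data.Product using (∃; _×_; _,_)
open import Data.Sum using (_⊎_; inj₁; inj₂; [_,_]′)
open import Function using (_∘_)
open import Level using (Level)
open import Relation.Nullary using (¬_; Dec; yes; no; does; contradiction)
open import Relation.Nullary.Decidable using (map′; _×-dec_; _⊎-dec_; ¬?; dec-true; decidable-stable)
open import Relation.Unary using (Pred; Decidable)
open import Relation.Binary.PropositionalEquality using (_≡_; _≢_; refl; sym; trans)

private
  variable
    a ℓ : Level
    A : Set a
    n : ℕ

module _ {P : Pred (Fin n) ℓ} (P? : Decidable P) where

  subsetOf : Subset n
  subsetOf = tabulate (does ∘ P?)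

  ∈-subsetOf⁺ : ∀ {x} → P x → x ∈ subsetOf
  ∈-subsetOf⁺ {x} px = lookup⇒[]= x subsetOf (trans (lookup∘tabulate _ x) (dec-true (P? x) px))

  ∈-subsetOf⁻ : ∀ {x} → x ∈ subsetOf → P x
  ∈-subsetOf⁻ {x} x∈ with P? x | trans (sym (lookup∘tabulate _ x)) ([]=⇒lookup x∈)
  ... | yes px | _ = px

subsetOf-⊂ : ∀ {P Q : Pred (Fin n) ℓ} (P? : Decidable P) (Q? : Decidable Q) →
             (∀ {x} → P x → Q x) → ∀ {y} → Q y → ¬ P y → subsetOf P? ⊂ subsetOf Q?
subsetOf-⊂ P? Q? P⇒Q {y} qy ¬py =
  ∈-subsetOf⁺ Q? ∘ P⇒Q ∘ ∈-subsetOf⁻ P? , y , ∈-subsetOf⁺ Q? qy , ¬py ∘ ∈-subsetOf⁻ P?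

ascend : {P : Pred A ℓ} (f : A → Subset n) →
         (∀ x → P x ⊎ ∃ λ y → f x ⊂ f y) → A → ∃ P
ascend {P = P} f P-or-ascent x = climb x (⊃-wellFounded (f x))
  where
  climb : ∀ x → Acc _⊃_ (f x) → ∃ P
  climb x (acc larger) with P-or-ascent x
  ... | inj₁ px = x , px
  ... | inj₂ (y , fx⊂fy) = climb y (larger fx⊂fy)

module _ (G : ChickenGraph n) where
  open ChickenGraph G

  pecks⇒flock≢ : ∀ {c d} → pecks c d ≡ true → flock c ≢ flock d
  pecks⇒flock≢ {c} {d} cd eq with () ← trans (sym cd) (noPeckSameFlock c d eq)

  pecks-or-pecked : ∀ {c d} → flock c ≢ flock d → pecks c d ≡ true ⊎ pecks d c ≡ true
  pecks-or-pecked {c} {d} c≢d with pecks c d | orient c d c≢d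
  ... | true  | _  = inj₁ refl
  ... | false | dc = inj₂ dc

  reach-refl : ∀ {m c} → ReachWithin G m c c
  reach-refl = within z≤n here

  reach-step : ∀ {m c d e} → pecks c d ≡ true → ReachWithin G m d e → ReachWithin G (suc m) c e
  reach-step cd (within l≤m chain) = within (s≤s l≤m) (step cd chain)

  reach-mono : ∀ {m m′ c d} → m ≤ m′ → ReachWithin G m c d → ReachWithin G m′ c d
  reach-mono m≤m′ (within l≤m chain) = within (≤-trans l≤m m≤m′) chain

  reach-zero⁻ : ∀ {c d} → ReachWithin G 0 c d → c ≡ d
  reach-zero⁻ (within z≤n here) = refl

  reach-suc⁻ : ∀ {m c e} → ReachWithin G (suc m) c e →
               c ≡ e ⊎ ∃ λ d → pecks c d ≡ true × ReachWithin G m d e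
  reach-suc⁻ (within z≤n here) = inj₁ refl
  reach-suc⁻ (within (s≤s l≤m) (step cd chain)) = inj₂ (_ , cd , within l≤m chain)

  reach? : ∀ m c d → Dec (ReachWithin G m c d)
  reach? zero    c d = map′ (λ { refl → reach-refl }) reach-zero⁻ (c ≟ d)
  reach? (suc m) c e =
    map′ [ (λ { refl → reach-refl }) , (λ { (d , cd , de) → reach-step cd de }) ]′ reach-suc⁻
         ((c ≟ e) ⊎-dec any? (λ d → (pecks c d Bool.≟ true) ×-dec reach? m d e))

  duke-or-escapee : ∀ v → IsDuke G 3 v ⊎ ∃ λ u → flock u ≢ flock v × ¬ ReachWithin G 3 v u
  duke-or-escapee v with any? (λ u → ¬? (flock u ≟ flock v) ×-dec ¬? (reach? 3 v u))
  ... | yes escapee = inj₂ escapee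
  ... | no ¬escapee = inj₁ λ c c≢v → decidable-stable (reach? 3 v c) λ ¬vc → ¬escapee (c , c≢v , ¬vc)

  escapee-dominates : ∀ {v u} → flock u ≢ flock v → ¬ ReachWithin G 3 v u →
                      ∀ {b} → ReachWithin G 2 v b → ReachWithin G 2 u b
  escapee-dominates {u = u} u≢v ¬vu v↝b with pecks-or-pecked u≢v | reach-suc⁻ v↝b
  ... | inj₂ vu | _ = contradiction (reach-step vu reach-refl) ¬vu
  ... | inj₁ uv | inj₁ refl = reach-step uv reach-refl
  ... | inj₁ uv | inj₂ (w , vw , w↝b) with reach-suc⁻ w↝b
  ...   | inj₁ refl = reach-step uv (reach-step vw reach-refl)
  ...   | inj₂ (_ , wb , b↝b) with refl ← reach-zero⁻ b↝b with flock w ≟ flock u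
  ...     | yes w≡u = [ (λ ub → reach-step ub reach-refl)
                      , (λ bu → contradiction (reach-step vw (reach-step wb (reach-step bu reach-refl))) ¬vu)
                      ]′ (pecks-or-pecked (λ u≡b → pecks⇒flock≢ wb (trans w≡u u≡b)))
  ...     | no  w≢u = [ (λ uw → reach-step uw (reach-step wb reach-refl))
                      , (λ wu → contradiction (reach-step vw (reach-step wu reach-refl)) ¬vu)
                      ]′ (pecks-or-pecked (w≢u ∘ sym))

  reach₂-set : Fin n → Subset n
  reach₂-set v = subsetOf (reach? 2 v)

  duke-or-ascent : ∀ v → IsDuke G 3 v ⊎ ∃ λ u → reach₂-set v ⊂ reach₂-set u
  duke-or-ascent v with duke-or-escapee v
  ... | inj₁ duke = inj₁ duke
  ... | inj₂ (u , u≢v , ¬vu) =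
    inj₂ (u , subsetOf-⊂ (reach? 2 v) (reach? 2 u) (escapee-dominates {u = u} u≢v ¬vu)
                         reach-refl (¬vu ∘ reach-mono (n≤1+n 2)))

theorem2 : (n : ℕ) (G : ChickenGraph (suc n)) → ∃ λ (d : Fin (suc n)) → IsDuke G 3 d
theorem2 n G = ascend (reach₂-set G) (duke-or-ascent G) zero
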